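{- Let $\mathcal{C}$ be a category whose objects are all finite ordered trees, where for trees $S,T$ each morphism in $\mathrm{Hom}_{\mathcal{C}}(S,T)$ is a pair $(s,i)$ with $s\colon T\to S$ and $i\colon S\to T$, and where composition is given by $(t,j)\circ(s,i)=(s\circ t,\ j\circ i)$ for $(s,i)\in\mathrm{Hom}_{\mathcal{C}}(S,T)$, $(t,j)\in\mathrm{Hom}_{\mathcal{C}}(T,V)$. Suppose: (1) for all trees $S,T$ and $(s,i)\in\mathrm{Hom}_{\mathcal{C}}(S,T)$, $s\colon T\to S$ is a rigid surjection, $i\colon S\to T$ is an embedding, and $s\circ i=\mathrm{Id}_S$; (2) for all trees $S,T$ and every rigid surjection $s\colon T\to S$, we have $(s,i_s)\in\mathrm{Hom}_{\mathcal{C}}(S,T)$; (3) there are trees $S,T$ and $(s,i)\in\mathrm{Hom}_{\mathcal{C}}(S,T)$ with $i\neq i_s$. Then $\mathcal{C}$ does not have the Ramsey property.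
   Context: All trees are finite. A tree is a partial order $(T,\sqsubseteq_T)$ with a least element (the root) such that the predecessors of every element are linearly ordered by $\sqsubseteq_T$; $v\wedge_T w$ denotes the largest common predecessor of $v,w$. A tree is ordered if for each $v$ the set of immediate successors of $v$ carries a linear order $\leq_v$; this extends to a linear order $\leq_T$ on $T$: $v\leq_T w$ iff $v\sqsubseteq_T w$, or $w\not\sqsubseteq_T v$ and $x\leq_{v\wedge w} y$ where $x,y$ are the immediate successors of $v\wedge w$ with $x\sqsubseteq v$, $y\sqsubseteq w$. All trees are ordered. An embedding $i\colon S\to T$ is a map sending the root to the root, with $x<_S y\Rightarrow i(x)<_T i(y)$, and $i(x\wedge_S y)=i(x)\wedge_T i(y)$ for all $x,y$. A map $s\colon T\to S$ is a rigid surjection if there is an embedding $i\colon S\to T$ with $s(i(x))=x$ and $i(s(y))\sqsubseteq_T y$ for all $x\in S$, $y\in T$; such $i$ is unique and equals $i_s(x)=\bigwedge s^{ -1}(x)$. For objects $A,B,C$ of a category and $r>0$, $C\to(B)^A_r$ means: for every coloring of $\mathrm{Hom}(A,C)$ with $r$ colors there is $f\in\mathrm{Hom}(B,C)$ such that $f\circ\mathrm{Hom}(A,B)$ is monochromatic. A category has the Ramsey property if for all objects $A,B$ and all $r>0$ there is an object $C$ with $C\to(B)^A_r$. -}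

module Defs where

open import Data.Nat using (ℕ; _<_)
open import Data.Fin as Fin using (Fin; zero; suc)
open import Data.List using (List; []; _∷_; length; lookup; map; _++_; filter; foldr)
open import Data.Product using (Σ; Σ-syntax; _×_; _,_; ∃)
open import Data.Empty using (⊥)
open import Relation.Nullary using (¬_; Dec; yes; no)
open import Relation.Binary.PropositionalEquality using (_≡_; _≢_; refl; cong)
open import Function using (_∘_; id)

-- Finite ordered trees: rose trees.  The immediate successors of a node
-- are its children, linearly ordered by their index in the list.

data Tree : Set where
  node : List Tree → Tree

data Pos : Tree → Set where
  root  : ∀ {ts} → Pos (node ts)
  child : ∀ {ts} (k : Fin (length ts)) → Pos (lookup ts k) → Pos (node ts)

data _⊑_ : ∀ {T} → Pos T → Pos T → Set where
  root⊑  : ∀ {ts} {p : Pos (node ts)} → root ⊑ p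
  child⊑ : ∀ {ts} {k : Fin (length ts)} {p q : Pos (lookup ts k)} →
           p ⊑ q → child {ts} k p ⊑ child k q

_∧_ : ∀ {T} → Pos T → Pos T → Pos T
root ∧ _ = root
child k p ∧ root = root
child k p ∧ child l q with k Fin.≟ l
... | yes refl = child k (p ∧ q)
... | no _ = root

data _≤L_ : ∀ {T} → Pos T → Pos T → Set where
  root≤  : ∀ {ts} {p : Pos (node ts)} → root ≤L p
  child< : ∀ {ts} {k l : Fin (length ts)} {p : Pos (lookup ts k)} {q : Pos (lookup ts l)} →
           Fin.toℕ k < Fin.toℕ l → child {ts} k p ≤L child l q
  child≤ : ∀ {ts} {k : Fin (length ts)} {p q : Pos (lookup ts k)} →
           p ≤L q → child {ts} k p ≤L child k q

_<L_ : ∀ {T} → Pos T → Pos T → Set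
x <L y = x ≤L y × x ≢ y

rootOf : (T : Tree) → Pos T
rootOf (node ts) = root

IsEmbedding : ∀ {S T} → (Pos S → Pos T) → Set
IsEmbedding {S} {T} i =
  (i (rootOf S) ≡ rootOf T) ×
  (∀ x y → x <L y → i x <L i y) ×
  (∀ x y → i (x ∧ y) ≡ i x ∧ i y)

IsRigidSurjection : ∀ {S T} → (Pos T → Pos S) → Set
IsRigidSurjection {S} {T} s =
  Σ[ i ∈ (Pos S → Pos T) ]
    IsEmbedding i × (∀ x → s (i x) ≡ x) × (∀ y → i (s y) ⊑ y)

-- i_s(x) = ⋀ s⁻¹(x), computed via an enumeration of the vertices.

child-inj : ∀ {ts} {k : Fin (length ts)} {p q : Pos (lookup ts k)} →
            child {ts} k p ≡ child k q → p ≡ q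
child-inj refl = refl

_≟P_ : ∀ {T} (x y : Pos T) → Dec (x ≡ y)
root ≟P root = yes refl
root ≟P child _ _ = no λ ()
child _ _ ≟P root = no λ ()
child k p ≟P child l q with k Fin.≟ l
... | no k≢l = no λ { refl → k≢l refl }
... | yes refl with p ≟P q
...   | yes refl = yes refl
...   | no p≢q = no (λ e → p≢q (child-inj e))

mutual
  allPos : (T : Tree) → List (Pos T)
  allPos (node ts) = root ∷ map (λ { (k , p) → child k p }) (allPosL ts)

  allPosL : (ts : List Tree) → List (Σ[ k ∈ Fin (length ts) ] Pos (lookup ts k))
  allPosL [] = []
  allPosL (t ∷ ts) =
    map (λ p → (zero , p)) (allPos t) ++
    map (λ { (k , p) → (suc k , p) }) (allPosL ts)

-- Meet of a finite list of vertices.  The value on the empty list is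
-- irrelevant here (preimages under surjections are nonempty).
⋀ : ∀ {T} → List (Pos T) → Pos T
⋀ {T} [] = rootOf T
⋀ (x ∷ []) = x
⋀ (x ∷ y ∷ xs) = x ∧ ⋀ (y ∷ xs)

preimage : ∀ {S T} → (Pos T → Pos S) → Pos S → List (Pos T)
preimage {S} {T} s x = filter (λ y → s y ≟P x) (allPos T)

iₛ : ∀ {S T} → (Pos T → Pos S) → Pos S → Pos T
iₛ s x = ⋀ (preimage s x)

-- The Hom-sets are given by a
-- membership predicate; identities and closure under composition make C
-- a category (associativity/unit laws hold by function composition).

record TreeCategory : Set₁ where
  field
    Hom   : (S T : Tree) → (Pos T → Pos S) → (Pos S → Pos T) → Set
    idHom : ∀ S → Hom S S id id
    comp  : ∀ {S T V} {s : Pos T → Pos S} {i : Pos S → Pos T}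
              {t : Pos V → Pos T} {j : Pos T → Pos V} →
            Hom T V t j → Hom S T s i → Hom S V (s ∘ t) (j ∘ i)

  Mor : Tree → Tree → Set
  Mor S T = Σ[ s ∈ (Pos T → Pos S) ] Σ[ i ∈ (Pos S → Pos T) ] Hom S T s i

  _∘C_ : ∀ {S T V} → Mor T V → Mor S T → Mor S V
  (t , j , h) ∘C (s , i , g) = (s ∘ t , j ∘ i , comp h g)

  Arrows : (C B A : Tree) (r : ℕ) → Set
  Arrows C B A r =
    (c : Mor A C → Fin r) →
    Σ[ f ∈ Mor B C ] (∀ (g g′ : Mor A B) → c (f ∘C g) ≡ c (f ∘C g′))

  RamseyProperty : Set
  RamseyProperty = ∀ (A B : Tree) (r : ℕ) → 0 < r → Σ[ C ∈ Tree ] Arrows C B A r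

{-# OPTIONS --safe #-}
module Submission where

-- Colour a morphism (t , j) out of the two-element chain by whether j agrees with the
-- canonical section iₛ t at the top point.  For a morphism (u , k) and any vertex y one has
-- iₛ u y ⊑ k y, and iₛ u is injective and preserves meets.  Hence at a branching vertex
-- y₁ ∧ y₂ the section k must agree with iₛ u (otherwise iₛ u y₁ and iₛ u y₂ would become
-- comparable), while for Q strictly below P we can never have k P ≡ iₛ u Q.  Let B be T with
-- a fresh branching vertex added at the root.  The chain mapped canonically onto the branching
-- vertex stays canonical after composing with any f : B → C, whereas a morphism (s , i) with
-- i x₀ ≢ iₛ s x₀ yields a morphism from the chain into B that stays non-canonical.  So no
-- f : B → C makes Hom(chain, B) monochromatic.

open import Defs
open import Data.Product using (Σ-syntax; _×_; _,_; proj₁; proj₂)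
open import Data.Sum using (_⊎_; inj₁; inj₂)
open import Data.Empty using (⊥-elim)
open import Data.Nat using (s≤s; z≤n)
open import Data.Fin as Fin using (Fin; zero; suc)
open import Data.List using (List; []; _∷_; length; lookup)
open import Data.List.Relation.Unary.Any using (here; there)
open import Data.List.Membership.Propositional using (_∈_)
open import Data.List.Membership.Propositional.Properties
  using (∈-map⁺; ∈-++⁺ˡ; ∈-++⁺ʳ; ∈-filter⁺; ∈-filter⁻)
open import Function using (_∘_)
open import Relation.Nullary using (¬_; Dec; yes; no)
open import Relation.Nullary.Decidable using (decidable-stable)
open import Relation.Binary.PropositionalEquality
  using (_≡_; _≢_; refl; sym; trans; cong; cong₂; subst; module ≡-Reasoning)

⊑-refl : ∀ {T} (x : Pos T) → x ⊑ x
⊑-refl root        = root⊑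
⊑-refl (child k p) = child⊑ (⊑-refl p)

⊑-trans : ∀ {T} {x y z : Pos T} → x ⊑ y → y ⊑ z → x ⊑ z
⊑-trans root⊑       _          = root⊑
⊑-trans (child⊑ p) (child⊑ q) = child⊑ (⊑-trans p q)

⊑-antisym : ∀ {T} {x y : Pos T} → x ⊑ y → y ⊑ x → x ≡ y
⊑-antisym root⊑       root⊑       = refl
⊑-antisym (child⊑ p) (child⊑ q) = cong (child _) (⊑-antisym p q)

rootOf-⊑ : ∀ {T} (y : Pos T) → rootOf T ⊑ y
rootOf-⊑ {node _} _ = root⊑

rootOf-≤L : ∀ {T} (y : Pos T) → rootOf T ≤L y
rootOf-≤L {node _} _ = root≤

predecessors-comparable : ∀ {T} {x y z : Pos T} → x ⊑ z → y ⊑ z → x ⊑ y ⊎ y ⊑ x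
predecessors-comparable root⊑       _          = inj₁ root⊑
predecessors-comparable (child⊑ _) root⊑       = inj₂ root⊑
predecessors-comparable (child⊑ p) (child⊑ q) with predecessors-comparable p q
... | inj₁ x⊑y = inj₁ (child⊑ x⊑y)
... | inj₂ y⊑x = inj₂ (child⊑ y⊑x)

∧-child-≡ : ∀ {ts} (k : Fin (length ts)) (p q : Pos (lookup ts k)) →
            child {ts} k p ∧ child k q ≡ child k (p ∧ q)
∧-child-≡ k p q with k Fin.≟ k
... | yes refl = refl
... | no k≢k   = ⊥-elim (k≢k refl)

x∧y⊑x : ∀ {T} (x y : Pos T) → (x ∧ y) ⊑ x
x∧y⊑x root        _           = root⊑
x∧y⊑x (child k p) root        = root⊑
x∧y⊑x (child k p) (child l q) with k Fin.≟ l
... | yes refl = child⊑ (x∧y⊑x p q)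
... | no _     = root⊑

x∧y⊑y : ∀ {T} (x y : Pos T) → (x ∧ y) ⊑ y
x∧y⊑y root        _           = root⊑
x∧y⊑y (child k p) root        = root⊑
x∧y⊑y (child k p) (child l q) with k Fin.≟ l
... | yes refl = child⊑ (x∧y⊑y p q)
... | no _     = root⊑

∧-greatest : ∀ {T} {c x y : Pos T} → c ⊑ x → c ⊑ y → c ⊑ (x ∧ y)
∧-greatest root⊑ _ = root⊑
∧-greatest (child⊑ {k = k} {q = p} c⊑p) (child⊑ {q = q} c⊑q) =
  subst (_ ⊑_) (sym (∧-child-≡ k p q)) (child⊑ (∧-greatest c⊑p c⊑q))

x⊑y⇒x∧y≡x : ∀ {T} {x y : Pos T} → x ⊑ y → x ∧ y ≡ x
x⊑y⇒x∧y≡x {x = x} {y} x⊑y = ⊑-antisym (x∧y⊑x x y) (∧-greatest (⊑-refl x) x⊑y)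

y⊑x⇒x∧y≡y : ∀ {T} {x y : Pos T} → y ⊑ x → x ∧ y ≡ y
y⊑x⇒x∧y≡y {x = x} {y} y⊑x = ⊑-antisym (x∧y⊑y x y) (∧-greatest y⊑x (⊑-refl y))

PreservesMeets : ∀ {S T} → (Pos S → Pos T) → Set
PreservesMeets e = ∀ x y → e (x ∧ y) ≡ e x ∧ e y

module _ {S T : Tree} (e : Pos S → Pos T) where

  meets⇒⊑-mono : PreservesMeets e → ∀ {x y} → x ⊑ y → e x ⊑ e y
  meets⇒⊑-mono e-meets {x} {y} x⊑y =
    subst (_⊑ e y) (trans (sym (e-meets x y)) (cong e (x⊑y⇒x∧y≡x x⊑y))) (x∧y⊑y (e x) (e y))

  module _ (s : Pos T → Pos S) (section : ∀ x → s (e x) ≡ x) where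

    section⇒injective : ∀ {x y} → e x ≡ e y → x ≡ y
    section⇒injective {x} {y} ex≡ey = trans (sym (section x)) (trans (cong s ex≡ey) (section y))

    meets⇒⊑-reflect : PreservesMeets e → ∀ {x y} → e x ⊑ e y → x ⊑ y
    meets⇒⊑-reflect e-meets {x} {y} ex⊑ey =
      subst (_⊑ y) (section⇒injective (trans (e-meets x y) (x⊑y⇒x∧y≡x ex⊑ey))) (x∧y⊑y x y)

mutual
  allPos-complete : ∀ T (p : Pos T) → p ∈ allPos T
  allPos-complete (node ts) root        = here refl
  allPos-complete (node ts) (child k p) = there (∈-map⁺ _ (allPosL-complete ts k p))

  allPosL-complete : ∀ ts (k : Fin (length ts)) (p : Pos (lookup ts k)) → (k , p) ∈ allPosL ts
  allPosL-complete (t ∷ ts) zero    p = ∈-++⁺ˡ (∈-map⁺ _ (allPos-complete t p))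
  allPosL-complete (t ∷ ts) (suc k) p = ∈-++⁺ʳ _ (∈-map⁺ _ (allPosL-complete ts k p))

⋀-lowerBound : ∀ {T} {y : Pos T} {xs : List (Pos T)} → y ∈ xs → ⋀ xs ⊑ y
⋀-lowerBound {xs = x ∷ []}     (here refl) = ⊑-refl x
⋀-lowerBound {xs = x ∷ y ∷ xs} (here refl) = x∧y⊑x x (⋀ (y ∷ xs))
⋀-lowerBound {xs = x ∷ y ∷ xs} (there y∈) = ⊑-trans (x∧y⊑y x (⋀ (y ∷ xs))) (⋀-lowerBound y∈)

⋀-greatest : ∀ {T} {c y : Pos T} {xs : List (Pos T)} →
             y ∈ xs → (∀ {z} → z ∈ xs → c ⊑ z) → c ⊑ ⋀ xs
⋀-greatest {xs = x ∷ []}     _ c⊑ = c⊑ (here refl)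
⋀-greatest {xs = x ∷ y ∷ xs} _ c⊑ = ∧-greatest (c⊑ (here refl)) (⋀-greatest (here refl) (c⊑ ∘ there))

-- e x is the least element of s⁻¹(x), hence it is the meet iₛ s x.
iₛ-unique : ∀ {S T} (s : Pos T → Pos S) (e : Pos S → Pos T) →
            (∀ x → s (e x) ≡ x) → (∀ y → e (s y) ⊑ y) → ∀ x → iₛ s x ≡ e x
iₛ-unique {T = T} s e section below x =
  ⊑-antisym (⋀-lowerBound ex∈s⁻¹x) (⋀-greatest ex∈s⁻¹x ex⊑)
  where
  ex∈s⁻¹x : e x ∈ preimage s x
  ex∈s⁻¹x = ∈-filter⁺ (λ y → s y ≟P x) (allPos-complete T (e x)) (section x)

  ex⊑ : ∀ {z} → z ∈ preimage s x → e x ⊑ z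
  ex⊑ {z} z∈s⁻¹x =
    subst (λ w → e w ⊑ z) (proj₂ (∈-filter⁻ (λ y → s y ≟P x) {xs = allPos T} z∈s⁻¹x)) (below z)

module _ {S T : Tree} {s : Pos T → Pos S} (rigid : IsRigidSurjection {S} {T} s) where

  iₛ-witness : ∀ x → iₛ s x ≡ proj₁ rigid x
  iₛ-witness = iₛ-unique s (proj₁ rigid) (proj₁ (proj₂ (proj₂ rigid))) (proj₂ (proj₂ (proj₂ rigid)))

  iₛ-section : ∀ x → s (iₛ s x) ≡ x
  iₛ-section x = trans (cong s (iₛ-witness x)) (proj₁ (proj₂ (proj₂ rigid)) x)

  iₛ-below : ∀ y → iₛ s (s y) ⊑ y
  iₛ-below y = subst (_⊑ y) (sym (iₛ-witness (s y))) (proj₂ (proj₂ (proj₂ rigid)) y)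

  iₛ-root : iₛ s (rootOf S) ≡ rootOf T
  iₛ-root = trans (iₛ-witness (rootOf S)) (proj₁ (proj₁ (proj₂ rigid)))

  iₛ-meets : PreservesMeets (iₛ s)
  iₛ-meets x y = begin
    iₛ s (x ∧ y)                     ≡⟨ iₛ-witness (x ∧ y) ⟩
    proj₁ rigid (x ∧ y)              ≡⟨ proj₂ (proj₂ (proj₁ (proj₂ rigid))) x y ⟩
    proj₁ rigid x ∧ proj₁ rigid y    ≡⟨ cong₂ _∧_ (iₛ-witness x) (iₛ-witness y) ⟨
    iₛ s x ∧ iₛ s y                  ∎
    where open ≡-Reasoning

  iₛ-least : ∀ {k : Pos S → Pos T} → (∀ x → s (k x) ≡ x) → ∀ x → iₛ s x ⊑ k x
  iₛ-least {k} section x = subst (λ w → iₛ s w ⊑ k x) (section x) (iₛ-below (k x))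

iₛ-∘ : ∀ {S T V} {s : Pos T → Pos S} {t : Pos V → Pos T} →
       IsRigidSurjection {S} {T} s → IsRigidSurjection {T} {V} t →
       ∀ x → iₛ (s ∘ t) x ≡ iₛ t (iₛ s x)
iₛ-∘ {s = s} {t} s-rigid t-rigid = iₛ-unique (s ∘ t) (iₛ t ∘ iₛ s) section below
  where
  section : ∀ x → s (t (iₛ t (iₛ s x))) ≡ x
  section x = trans (cong s (iₛ-section t-rigid (iₛ s x))) (iₛ-section s-rigid x)

  below : ∀ y → iₛ t (iₛ s (s (t y))) ⊑ y
  below y =
    ⊑-trans (meets⇒⊑-mono (iₛ t) (iₛ-meets t-rigid) (iₛ-below s-rigid (t y))) (iₛ-below t-rigid y)

module _ {B C : Tree} {u : Pos C → Pos B} {k : Pos B → Pos C}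
         (u-rigid : IsRigidSurjection {B} {C} u) (k-section : ∀ x → u (k x) ≡ x) where

  private
    reflect : ∀ {x y} → iₛ u x ⊑ iₛ u y → x ⊑ y
    reflect = meets⇒⊑-reflect (iₛ u) u (iₛ-section u-rigid) (iₛ-meets u-rigid)

    iₛ⊑k : ∀ x → iₛ u x ⊑ k x
    iₛ⊑k = iₛ-least u-rigid k-section

  section≢iₛ-below : ∀ {P Q} → Q ⊑ P → Q ≢ P → k P ≢ iₛ u Q
  section≢iₛ-below {P} Q⊑P Q≢P kP≡ρQ =
    Q≢P (⊑-antisym Q⊑P (reflect (subst (iₛ u P ⊑_) kP≡ρQ (iₛ⊑k P))))

  section≡iₛ-at-fork : PreservesMeets k → ∀ {y₁ y₂} → ¬ y₁ ⊑ y₂ → ¬ y₂ ⊑ y₁ →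
                       k (y₁ ∧ y₂) ≡ iₛ u (y₁ ∧ y₂)
  section≡iₛ-at-fork k-meets {y₁} {y₂} y₁⋢y₂ y₂⋢y₁ =
    ⊑-antisym kz⊑ρz (iₛ⊑k (y₁ ∧ y₂))
    where
    kz⊑ky₁ : k (y₁ ∧ y₂) ⊑ k y₁
    kz⊑ky₁ = meets⇒⊑-mono k k-meets (x∧y⊑x y₁ y₂)

    kz⊑ky₂ : k (y₁ ∧ y₂) ⊑ k y₂
    kz⊑ky₂ = meets⇒⊑-mono k k-meets (x∧y⊑y y₁ y₂)

    -- k (y₁ ∧ y₂) and iₛ u a both lie below k a, so they are comparable; and iₛ u a cannot lie
    -- below k (y₁ ∧ y₂) ⊑ k b, for then iₛ u a and iₛ u b would both lie below k b.
    kz⊑ρ : ∀ {a b} → k (y₁ ∧ y₂) ⊑ k a → k (y₁ ∧ y₂) ⊑ k b →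
           ¬ a ⊑ b → ¬ b ⊑ a → k (y₁ ∧ y₂) ⊑ iₛ u a
    kz⊑ρ {a} {b} kz⊑ka kz⊑kb a⋢b b⋢a
      with predecessors-comparable kz⊑ka (iₛ⊑k a)
    ... | inj₁ kz⊑ρa = kz⊑ρa
    ... | inj₂ ρa⊑kz with predecessors-comparable (⊑-trans ρa⊑kz kz⊑kb) (iₛ⊑k b)
    ...   | inj₁ ρa⊑ρb = ⊥-elim (a⋢b (reflect ρa⊑ρb))
    ...   | inj₂ ρb⊑ρa = ⊥-elim (b⋢a (reflect ρb⊑ρa))

    kz⊑ρz : k (y₁ ∧ y₂) ⊑ iₛ u (y₁ ∧ y₂)
    kz⊑ρz = subst (k (y₁ ∧ y₂) ⊑_) (sym (iₛ-meets u-rigid y₁ y₂))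
                  (∧-greatest (kz⊑ρ kz⊑ky₁ kz⊑ky₂ y₁⋢y₂ y₂⋢y₁) (kz⊑ρ kz⊑ky₂ kz⊑ky₁ y₂⋢y₁ y₁⋢y₂))

leaf : Tree
leaf = node []

chain₂ : Tree
chain₂ = node (leaf ∷ [])

pattern top = child zero root

module Collapse {X : Tree} (z : Pos X) (z≢root : z ≢ rootOf X) where

  collapse : Pos X → Pos chain₂
  collapse y with y ≟P z
  ... | yes _ = top
  ... | no _  = root

  pick : Pos chain₂ → Pos X
  pick root        = rootOf X
  pick (child _ _) = z

  collapse-pick : ∀ x → collapse (pick x) ≡ x
  collapse-pick root with rootOf X ≟P z
  ... | yes root≡z = ⊥-elim (z≢root (sym root≡z))
  ... | no _       = refl
  collapse-pick top with z ≟P z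
  ... | yes _  = refl
  ... | no z≢z = ⊥-elim (z≢z refl)
  collapse-pick (child zero (child () _))
  collapse-pick (child (suc ()) _)

  pick-collapse : ∀ y → pick (collapse y) ⊑ y
  pick-collapse y with y ≟P z
  ... | yes refl = ⊑-refl y
  ... | no _     = rootOf-⊑ y

  pick-<L : ∀ x y → x <L y → pick x <L pick y
  pick-<L root        root        (_ , x≢y) = ⊥-elim (x≢y refl)
  pick-<L root        (child _ _) _         = rootOf-≤L z , z≢root ∘ sym
  pick-<L (child _ _) root        (() , _)
  pick-<L top         top         (_ , x≢y) = ⊥-elim (x≢y refl)
  pick-<L _ (child zero (child () _)) _
  pick-<L _ (child (suc ()) _)        _
  pick-<L (child zero (child () _)) _ _
  pick-<L (child (suc ()) _)        _ _

  pick-meets : PreservesMeets pick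
  pick-meets root y    = sym (x⊑y⇒x∧y≡x (rootOf-⊑ (pick y)))
  pick-meets top  root = sym (y⊑x⇒x∧y≡y (rootOf-⊑ z))
  pick-meets top  top  = sym (x⊑y⇒x∧y≡x (⊑-refl z))
  pick-meets _ (child zero (child () _))
  pick-meets _ (child (suc ()) _)
  pick-meets (child zero (child () _)) _
  pick-meets (child (suc ()) _)        _

  collapse-rigid : IsRigidSurjection {chain₂} {X} collapse
  collapse-rigid = pick , (refl , pick-<L , pick-meets) , collapse-pick , pick-collapse

  iₛ-collapse : iₛ collapse top ≡ z
  iₛ-collapse = iₛ-witness collapse-rigid top

module Sprout (ts : List Tree) where

  sprout : Tree
  sprout = node (node (leaf ∷ leaf ∷ []) ∷ ts)

  prune : Pos sprout → Pos (node ts)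
  prune root              = root
  prune (child zero _)    = root
  prune (child (suc k) p) = child k p

  graft : Pos (node ts) → Pos sprout
  graft root        = root
  graft (child k p) = child (suc k) p

  prune-graft : ∀ x → prune (graft x) ≡ x
  prune-graft root        = refl
  prune-graft (child _ _) = refl

  graft-prune : ∀ y → graft (prune y) ⊑ y
  graft-prune root              = root⊑
  graft-prune (child zero _)    = root⊑
  graft-prune (child (suc k) p) = ⊑-refl _

  graft-≤L : ∀ {x y} → x ≤L y → graft x ≤L graft y
  graft-≤L root≤        = root≤
  graft-≤L (child< k<l) = child< (s≤s k<l)
  graft-≤L (child≤ p≤q) = child≤ p≤q

  graft-<L : ∀ x y → x <L y → graft x <L graft y
  graft-<L x y (x≤y , x≢y) = graft-≤L x≤y , x≢y ∘ section⇒injective graft prune prune-graft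

  graft-meets : PreservesMeets graft
  graft-meets root        _           = refl
  graft-meets (child k p) root        = refl
  graft-meets (child k p) (child l q) with k Fin.≟ l
  ... | yes refl = refl
  ... | no _     = refl

  prune-rigid : IsRigidSurjection {node ts} {sprout} prune
  prune-rigid = graft , (refl , graft-<L , graft-meets) , prune-graft , graft-prune

  iₛ-prune : ∀ x → iₛ prune x ≡ graft x
  iₛ-prune = iₛ-witness prune-rigid

  left right fork : Pos sprout
  left  = child zero (child zero root)
  right = child zero (child (suc zero) root)
  fork  = left ∧ right

  left⋢right : ¬ left ⊑ right
  left⋢right (child⊑ ())

  right⋢left : ¬ right ⊑ left
  right⋢left (child⊑ ())

indicator : ∀ {P : Set} → Dec P → Fin 2
indicator (yes _) = zero
indicator (no _)  = suc zero

indicator-transfer : ∀ {P Q : Set} (p? : Dec P) (q? : Dec Q) → indicator p? ≡ indicator q? → P → Q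
indicator-transfer (yes _) (yes q) _  _ = q
indicator-transfer (yes _) (no _)  () _
indicator-transfer (no ¬p) _       _  p = ⊥-elim (¬p p)

module Obstruction (𝓒 : TreeCategory) where
  open TreeCategory 𝓒

  module _ (split : ∀ {S T} {s : Pos T → Pos S} {i : Pos S → Pos T} → Hom S T s i →
                    IsRigidSurjection {S} {T} s × IsEmbedding {S} {T} i × (∀ x → s (i x) ≡ x))
           (canonical : ∀ {S T} (s : Pos T → Pos S) → IsRigidSurjection {S} {T} s → Hom S T s (iₛ s))
           where

    module _ {S T} {s : Pos T → Pos S} {i : Pos S → Pos T} (h : Hom S T s i) where

      hom-rigid : IsRigidSurjection {S} {T} s
      hom-rigid = proj₁ (split h)

      hom-root : i (rootOf S) ≡ rootOf T
      hom-root = proj₁ (proj₁ (proj₂ (split h)))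

      hom-meets : PreservesMeets i
      hom-meets = proj₂ (proj₂ (proj₁ (proj₂ (split h))))

      hom-section : ∀ x → s (i x) ≡ x
      hom-section = proj₂ (proj₂ (split h))

    canonicalMor : ∀ {S T} {s : Pos T → Pos S} → IsRigidSurjection {S} {T} s → Mor S T
    canonicalMor {s = s} rigid = s , iₛ s , canonical s rigid

    iₛ-∘C : ∀ {S T V} (f : Mor T V) (g : Mor S T) →
            ∀ x → iₛ (proj₁ (f ∘C g)) x ≡ iₛ (proj₁ f) (iₛ (proj₁ g) x)
    iₛ-∘C (_ , _ , hf) (_ , _ , hg) = iₛ-∘ (hom-rigid hg) (hom-rigid hf)

    CanonicalAtTop : ∀ {C} → Mor chain₂ C → Set
    CanonicalAtTop (t , j , _) = j top ≡ iₛ t top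

    colour : ∀ {C} → Mor chain₂ C → Fin 2
    colour (t , j , _) = indicator (j top ≟P iₛ t top)

    module _ {S ts} {s : Pos (node ts) → Pos S} {i : Pos S → Pos (node ts)} (h : Hom S (node ts) s i)
             {x₀ : Pos S} (i≢iₛ : i x₀ ≢ iₛ s x₀) where
      open Sprout ts
      open ≡-Reasoning

      x₀≢root : x₀ ≢ rootOf S
      x₀≢root refl = i≢iₛ (trans (hom-root h) (sym (iₛ-root (hom-rigid h))))

      module Fork = Collapse fork (λ ())
      module X₀ = Collapse x₀ x₀≢root

      through-fork : Mor chain₂ sprout
      through-fork = canonicalMor Fork.collapse-rigid

      onto-x₀ : Mor chain₂ S
      onto-x₀ = canonicalMor X₀.collapse-rigid

      via-x₀ : Mor chain₂ (node ts)
      via-x₀ = (s , i , h) ∘C onto-x₀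

      through-x₀ : Mor chain₂ sprout
      through-x₀ = canonicalMor prune-rigid ∘C via-x₀

      through-fork-canonical : ∀ {C} (f : Mor sprout C) → CanonicalAtTop (f ∘C through-fork)
      through-fork-canonical f@(u , k , hf) = begin
        k (iₛ Fork.collapse top)     ≡⟨ cong k Fork.iₛ-collapse ⟩
        k fork                       ≡⟨ section≡iₛ-at-fork (hom-rigid hf) (hom-section hf)
                                          (hom-meets hf) left⋢right right⋢left ⟩
        iₛ u fork                    ≡⟨ cong (iₛ u) Fork.iₛ-collapse ⟨
        iₛ u (iₛ Fork.collapse top)  ≡⟨ iₛ-∘C f through-fork top ⟨
        iₛ (Fork.collapse ∘ u) top   ∎

      through-x₀-top : iₛ prune (i (iₛ X₀.collapse top)) ≡ graft (i x₀)
      through-x₀-top = trans (cong (iₛ prune ∘ i) X₀.iₛ-collapse) (iₛ-prune (i x₀))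

      iₛ-through-x₀-top : iₛ (X₀.collapse ∘ s ∘ prune) top ≡ graft (iₛ s x₀)
      iₛ-through-x₀-top = begin
        iₛ (X₀.collapse ∘ s ∘ prune) top      ≡⟨ iₛ-∘C (canonicalMor prune-rigid) via-x₀ top ⟩
        iₛ prune (iₛ (X₀.collapse ∘ s) top)   ≡⟨ cong (iₛ prune) (iₛ-∘C (s , i , h) onto-x₀ top) ⟩
        iₛ prune (iₛ s (iₛ X₀.collapse top))  ≡⟨ cong (iₛ prune ∘ iₛ s) X₀.iₛ-collapse ⟩
        iₛ prune (iₛ s x₀)                    ≡⟨ iₛ-prune (iₛ s x₀) ⟩
        graft (iₛ s x₀)                       ∎

      through-x₀-noncanonical : ∀ {C} (f : Mor sprout C) → ¬ CanonicalAtTop (f ∘C through-x₀)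
      through-x₀-noncanonical f@(u , k , hf) canonicalAtTop =
        section≢iₛ-below (hom-rigid hf) (hom-section hf) graft-iₛx₀⊑graft-ix₀
          (i≢iₛ ∘ sym ∘ section⇒injective graft prune prune-graft) (begin
          k (graft (i x₀))                         ≡⟨ cong k through-x₀-top ⟨
          k (iₛ prune (i (iₛ X₀.collapse top)))    ≡⟨ canonicalAtTop ⟩
          iₛ (X₀.collapse ∘ s ∘ prune ∘ u) top     ≡⟨ iₛ-∘C f through-x₀ top ⟩
          iₛ u (iₛ (X₀.collapse ∘ s ∘ prune) top)  ≡⟨ cong (iₛ u) iₛ-through-x₀-top ⟩
          iₛ u (graft (iₛ s x₀))                   ∎)
        where
        graft-iₛx₀⊑graft-ix₀ : graft (iₛ s x₀) ⊑ graft (i x₀)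
        graft-iₛx₀⊑graft-ix₀ =
          meets⇒⊑-mono graft graft-meets (iₛ-least (hom-rigid h) (hom-section h) x₀)

      no-arrow : ∀ C → ¬ Arrows C sprout chain₂ 2
      no-arrow C arrows =
        let (f , monochromatic) = arrows colour
            sameColour = monochromatic through-fork through-x₀
        in through-x₀-noncanonical f (indicator-transfer _ _ sameColour (through-fork-canonical f))

    ramsey⇒canonical : RamseyProperty → ∀ {S T} {s : Pos T → Pos S} {i : Pos S → Pos T} →
                       Hom S T s i → ∀ x → i x ≡ iₛ s x
    ramsey⇒canonical ramsey {T = node ts} {s} {i} h x =
      decidable-stable (i x ≟P iₛ s x) λ i≢iₛ →
        let (C , arrows) = ramsey chain₂ (Sprout.sprout ts) 2 (s≤s z≤n)
        in no-arrow h i≢iₛ C arrows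

theorem3p1 : (𝓒 : TreeCategory) →
    let open TreeCategory 𝓒 in
    (∀ {S T} {s : Pos T → Pos S} {i : Pos S → Pos T} → Hom S T s i →
       IsRigidSurjection {S} {T} s × IsEmbedding {S} {T} i × (∀ x → s (i x) ≡ x)) →
    (∀ {S T} (s : Pos T → Pos S) → IsRigidSurjection {S} {T} s → Hom S T s (iₛ s)) →
    (Σ[ S ∈ Tree ] Σ[ T ∈ Tree ] Σ[ s ∈ (Pos T → Pos S) ] Σ[ i ∈ (Pos S → Pos T) ]
       (Hom S T s i × ¬ (∀ x → i x ≡ iₛ s x))) →
    ¬ RamseyProperty
theorem3p1 𝓒 split canonical (_ , _ , _ , _ , h , i≉iₛ) ramsey =
  i≉iₛ (Obstruction.ramsey⇒canonical 𝓒 split canonical ramsey h)
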